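{- Let $\overrightarrow{H}$ be an absolute oriented clique on $n$ vertices and let $x$ be a source of $\overrightarrow{H}$. Then the oriented graph $\overrightarrow{H} - x$ obtained by deleting $x$ is also an absolute oriented clique.
   Context: An oriented graph is a finite directed graph with no loops, no multiple arcs and no directed cycle of length $2$. A homomorphism of an oriented graph $\overrightarrow{G}$ to an oriented graph $\overrightarrow{T}$ is a map $\phi:V(\overrightarrow{G})\to V(\overrightarrow{T})$ such that for every arc $uv$ of $\overrightarrow{G}$, $\phi(u)\phi(v)$ is an arc of $\overrightarrow{T}$. The oriented chromatic number $\chi_o(\overrightarrow{G})$ is the minimum $|V(\overrightarrow{T})|$ over such $\overrightarrow{T}$. An absolute oriented clique is an oriented graph $\overrightarrow{C}$ with $\chi_o(\overrightarrow{C}) = |V(\overrightarrow{C})|$; equivalently, every two distinct vertices are adjacent or joined by a directed path of length $2$ (in one direction or the other). A vertex is a source if all its neighbors are out-neighbors. -}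

module Defs where

open import Data.Nat using (ℕ; suc; _<_)
open import Data.Fin using (Fin; punchIn)
open import Data.Product using (Σ)
open import Relation.Nullary using (¬_)

record OrientedGraph (n : ℕ) : Set₁ where
  field
    Arc     : Fin n → Fin n → Set
    noLoop  : ∀ u → ¬ Arc u u
    no2Cyc  : ∀ u v → Arc u v → ¬ Arc v u
open OrientedGraph public

Hom : ∀ {n m} → OrientedGraph n → OrientedGraph m → Set
Hom {n} {m} G T = Σ (Fin n → Fin m) λ φ → ∀ u v → Arc G u v → Arc T (φ u) (φ v)

χo≤ : ∀ {n} → OrientedGraph n → ℕ → Set₁
χo≤ G k = Σ (OrientedGraph k) λ T → Hom G T

-- Absolute oriented clique: χ_o(C) = |V(C)| = n.  Since the identity map is
-- a homomorphism, χ_o(C) ≤ n always holds, so χ_o(C) = n says exactly that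
-- there is no homomorphism to an oriented graph with fewer than n vertices.
AbsoluteClique : ∀ {n} → OrientedGraph n → Set₁
AbsoluteClique {n} C = ∀ k → k < n → ¬ χo≤ C k

IsSource : ∀ {n} → OrientedGraph n → Fin n → Set
IsSource G x = ∀ y → ¬ Arc G y x

delete : ∀ {m} → OrientedGraph (suc m) → Fin (suc m) → OrientedGraph m
delete G x = record
  { Arc    = λ u v → Arc G (punchIn x u) (punchIn x v)
  ; noLoop = λ u → noLoop G (punchIn x u)
  ; no2Cyc = λ u v → no2Cyc G (punchIn x u) (punchIn x v)
  }

module Submission where

-- If G - x maps to T, send x to a new vertex that dominates all of T.  Since x
-- is a source, every arc at x leaves x and is preserved, so G maps to a graph
-- with one more vertex; hence χ_o(G - x) < m would give χ_o(G) < m + 1.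

open import Defs
open import Data.Nat using (ℕ; suc; s≤s)
open import Data.Fin using (Fin; zero; suc; punchOut; _≟_)
open import Data.Fin.Properties using (punchIn-punchOut)
open import Data.Product using (_,_)
open import Data.Empty using (⊥)
open import Data.Unit using (⊤; tt)
open import Relation.Nullary using (Dec; yes; no; ¬_)
open import Relation.Binary.PropositionalEquality using (_≡_; refl; sym; subst₂)

module _ {k : ℕ} (T : OrientedGraph k) where

  addSourceArc : Fin (suc k) → Fin (suc k) → Set
  addSourceArc zero    zero    = ⊥
  addSourceArc zero    (suc _) = ⊤
  addSourceArc (suc _) zero    = ⊥
  addSourceArc (suc a) (suc b) = Arc T a b

  addSourceArc-irrefl : ∀ u → ¬ addSourceArc u u
  addSourceArc-irrefl zero    ()
  addSourceArc-irrefl (suc a) = noLoop T a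

  addSourceArc-asym : ∀ u v → addSourceArc u v → ¬ addSourceArc v u
  addSourceArc-asym zero    (suc _) _ ()
  addSourceArc-asym (suc a) (suc b)   = no2Cyc T a b

  addSource : OrientedGraph (suc k)
  addSource = record
    { Arc    = addSourceArc
    ; noLoop = addSourceArc-irrefl
    ; no2Cyc = addSourceArc-asym
    }

module _ {m k : ℕ} (x : Fin (suc m)) (φ : Fin m → Fin k) where

  extendAt : (v : Fin (suc m)) → Dec (x ≡ v) → Fin (suc k)
  extendAt v (yes _)  = zero
  extendAt v (no x≢v) = suc (φ (punchOut x≢v))

  extend : Fin (suc m) → Fin (suc k)
  extend v = extendAt v (x ≟ v)

Hom-addSource : ∀ {m k} (G : OrientedGraph (suc m)) (x : Fin (suc m))
  (T : OrientedGraph k) → IsSource G x →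
  Hom (delete G x) T → Hom G (addSource T)
Hom-addSource G x T source (φ , φ-hom) = extend x φ , extend-hom
  where
  extend-hom : ∀ u v → Arc G u v → Arc (addSource T) (extend x φ u) (extend x φ v)
  extend-hom u v uv with x ≟ u | x ≟ v
  ... | yes refl | yes refl = noLoop G x uv
  ... | yes refl | no _     = tt
  ... | no _     | yes refl = source u uv
  ... | no x≢u   | no x≢v   = φ-hom (punchOut x≢u) (punchOut x≢v)
    (subst₂ (Arc G) (sym (punchIn-punchOut x≢u)) (sym (punchIn-punchOut x≢v)) uv)

χo≤-delete-source : ∀ {m k} (G : OrientedGraph (suc m)) (x : Fin (suc m)) →
  IsSource G x → χo≤ (delete G x) k → χo≤ G (suc k)
χo≤-delete-source G x source (T , φ) = addSource T , Hom-addSource G x T source φ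

lemma5 : (m : ℕ) (H : OrientedGraph (suc m)) (x : Fin (suc m)) →
    AbsoluteClique H → IsSource H x → AbsoluteClique (delete H x)
lemma5 m H x absolute source k k<m χ≤k =
  absolute (suc k) (s≤s k<m) (χo≤-delete-source H x source χ≤k)
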